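{- Let $n$ be a positive integer such that $2^{2^n}+1$ is prime. Then the system \[ \left\{\begin{array}{rcl} \forall i \in \{1,\ldots,n\}\ \ x_i \cdot x_i &=& x_{i+1} \\ x_{1}+1 &=& x_{n+2} \\ x_{n+2}+1 &=& x_{n+3} \\ x_{n+1}+1 &=& x_{n+4} \\ x_{n+3} \cdot x_{n+5} &=& x_{n+4} \end{array}\right. \] in the variables $x_1,\ldots,x_{n+5}$ has a unique solution $(a_1,\ldots,a_{n+5})$ in non-negative integers. The numbers $a_1,\ldots,a_{n+5}$ are positive and $\max(a_1,\ldots,a_{n+5})=a_{n+4}=\left(2^{2^n}-1\right)^{2^n}+1$. -}

module Defs where

open import Data.Nat using (ℕ; zero; suc; _+_; _*_; _∸_; _^_; _≤_; _<_)
open import Data.Fin using (Fin)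
import Data.Fin as F
open import Data.Product using (_×_)
open import Relation.Binary.PropositionalEquality using (_≡_)

-- A candidate assignment to the variables x_1, …, x_{n+5}:
-- the 0-based Fin index k stores x_{k+1}.
Assignment : ℕ → Set
Assignment n = Fin (n + 5) → ℕ

-- 0-based lookup into a finite tuple, defaulting to 0 out of range.
-- (Only ever used below with in-range indices.)
get : ∀ {m} → (Fin m → ℕ) → ℕ → ℕ
get {zero}  x k       = 0
get {suc m} x zero    = x F.zero
get {suc m} x (suc k) = get {m} (λ i → x (F.suc i)) k

X : ∀ {n} → Assignment n → ℕ → ℕ
X x j = get x (j ∸ 1)

System : (n : ℕ) → Assignment n → Set
System n x =
  (∀ i → 1 ≤ i → i ≤ n → X x i * X x i ≡ X x (suc i)) ×
  (X x 1 + 1 ≡ X x (n + 2)) ×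
  (X x (n + 2) + 1 ≡ X x (n + 3)) ×
  (X x (n + 1) + 1 ≡ X x (n + 4)) ×
  (X x (n + 3) * X x (n + 5) ≡ X x (n + 4))

{-# OPTIONS --safe #-}
module Submission where

-- Squaring along the chain forces x_{k+1} = x₁ ^ 2 ^ k, and the remaining equations force
-- x_{n+2} = x₁ + 1, x_{n+3} = x₁ + 2, x_{n+4} = x₁ ^ 2 ^ n + 1 and x_{n+5} = x_{n+4} / (x₁ + 2),
-- with x₁ + 2 ∣ x₁ ^ 2 ^ n + 1. As x₁ ≡ -2 modulo x₁ + 2 and 2 ^ n is even, x₁ + 2 then divides
-- the prime 2 ^ 2 ^ n + 1, so x₁ = 2 ^ 2 ^ n - 1; conversely this x₁ makes the division exact.

open import Data.Nat
open import Data.Nat.Properties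
open import Data.Nat.DivMod
open import Data.Nat.Divisibility
open import Data.Nat.Primality using (Prime; prime⇒irreducible)
open import Data.Nat.Tactic.RingSolver using (solve-∀)
open import Data.Fin using (Fin; toℕ)
import Data.Fin as F
open import Data.Fin.Properties using (toℕ<n)
open import Data.Product using (_,_; proj₁; proj₂; ∃-syntax; _×_)
open import Data.Sum using (inj₁; inj₂)
open import Function using (_∘_)
open import Relation.Binary.PropositionalEquality
open import Defs

infix 4 _≡_[mod_]
_≡_[mod_] : ℕ → ℕ → (d : ℕ) → .{{NonZero d}} → Set
x ≡ y [mod d ] = x % d ≡ y % d

*-cong-mod : ∀ {d} .{{_ : NonZero d}} {x y u v} →
             x ≡ y [mod d ] → u ≡ v [mod d ] → x * u ≡ y * v [mod d ]
*-cong-mod {d} {x} {y} {u} {v} x≡y u≡v = begin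
  x * u % d                 ≡⟨ %-distribˡ-* x u d ⟩
  (x % d) * (u % d) % d     ≡⟨ cong₂ (λ a b → a * b % d) x≡y u≡v ⟩
  (y % d) * (v % d) % d     ≡⟨ %-distribˡ-* y v d ⟨
  y * v % d                 ∎
  where open ≡-Reasoning

+-cong-mod : ∀ {d} .{{_ : NonZero d}} {x y u v} →
             x ≡ y [mod d ] → u ≡ v [mod d ] → x + u ≡ y + v [mod d ]
+-cong-mod {d} {x} {y} {u} {v} x≡y u≡v = begin
  (x + u) % d               ≡⟨ %-distribˡ-+ x u d ⟩
  (x % d + u % d) % d       ≡⟨ cong₂ (λ a b → (a + b) % d) x≡y u≡v ⟩
  (y % d + v % d) % d       ≡⟨ %-distribˡ-+ y v d ⟨
  (y + v) % d               ∎
  where open ≡-Reasoning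

^-cong-mod : ∀ {d} .{{_ : NonZero d}} {x y} → x ≡ y [mod d ] → ∀ k → x ^ k ≡ y ^ k [mod d ]
^-cong-mod x≡y zero    = refl
^-cong-mod x≡y (suc k) = *-cong-mod x≡y (^-cong-mod x≡y k)

∣-resp-mod : ∀ {d} .{{_ : NonZero d}} {x y} → x ≡ y [mod d ] → d ∣ x → d ∣ y
∣-resp-mod {d} {x} {y} x≡y d∣x = m%n≡0⇒n∣m y d (trans (sym x≡y) (n∣m⇒m%n≡0 x d d∣x))

square-shift : ∀ c → c * c + 2 * (2 + c) ≡ 4 + c * (2 + c)
square-shift = solve-∀

c²≡2²-mod-2+c : ∀ c → c ^ 2 ≡ 2 ^ 2 [mod 2 + c ]
c²≡2²-mod-2+c c = begin
  c ^ 2 % d               ≡⟨ cong (λ a → c * a % d) (*-identityʳ c) ⟩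
  c * c % d               ≡⟨ [m+kn]%n≡m%n (c * c) 2 d ⟨
  (c * c + 2 * d) % d     ≡⟨ cong (_% d) (square-shift c) ⟩
  (4 + c * d) % d         ≡⟨ [m+kn]%n≡m%n 4 c d ⟩
  2 ^ 2 % d               ∎
  where
  open ≡-Reasoning
  d : ℕ
  d = 2 + c

c^[2e]+1≡2^[2e]+1-mod-2+c : ∀ c e → c ^ (2 * e) + 1 ≡ 2 ^ (2 * e) + 1 [mod 2 + c ]
c^[2e]+1≡2^[2e]+1-mod-2+c c e = +-cong-mod {x = c ^ (2 * e)} {2 ^ (2 * e)} {1} {1} powers refl
  where
  open ≡-Reasoning
  d : ℕ
  d = 2 + c
  powers : c ^ (2 * e) ≡ 2 ^ (2 * e) [mod d ]
  powers = begin
    c ^ (2 * e) % d       ≡⟨ cong (_% d) (^-*-assoc c 2 e) ⟨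
    (c ^ 2) ^ e % d       ≡⟨ ^-cong-mod (c²≡2²-mod-2+c c) e ⟩
    (2 ^ 2) ^ e % d       ≡⟨ cong (_% d) (^-*-assoc 2 2 e) ⟩
    2 ^ (2 * e) % d       ∎

2+c∣p⇒2+c≡p : ∀ {c p} → Prime p → 2 + c ∣ p → 2 + c ≡ p
2+c∣p⇒2+c≡p p-prime 2+c∣p with prime⇒irreducible p-prime 2+c∣p
... | inj₁ ()
... | inj₂ 2+c≡p = 2+c≡p

-- The k-th entry (from 0) of (f 0, …, f (m + 1), t₂, t₃, t₄, t₅); for n = m + 1, tⱼ is x_{n+j}.
layout : ℕ → (ℕ → ℕ) → ℕ → ℕ → ℕ → ℕ → ℕ → ℕ
layout m       f t₂ t₃ t₄ t₅ zero                            = f 0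
layout zero    f t₂ t₃ t₄ t₅ (suc zero)                      = f 1
layout zero    f t₂ t₃ t₄ t₅ (suc (suc zero))                = t₂
layout zero    f t₂ t₃ t₄ t₅ (suc (suc (suc zero)))          = t₃
layout zero    f t₂ t₃ t₄ t₅ (suc (suc (suc (suc zero))))    = t₄
layout zero    f t₂ t₃ t₄ t₅ (suc (suc (suc (suc (suc _))))) = t₅
layout (suc m) f t₂ t₃ t₄ t₅ (suc k)                         = layout m (f ∘ suc) t₂ t₃ t₄ t₅ k

layout-≤ : ∀ m {f t₂ t₃ t₄ t₅ k} → k ≤ suc m → layout m f t₂ t₃ t₄ t₅ k ≡ f k
layout-≤ m       {k = zero}     _           = refl
layout-≤ zero    {k = suc zero} _           = refl
layout-≤ zero    {k = suc (suc _)} (s≤s ())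
layout-≤ (suc m) {f} {k = suc k} (s≤s k≤1+m) = layout-≤ m {f ∘ suc} k≤1+m

layout-+ : ∀ m {f t₂ t₃ t₄ t₅} j → layout m f t₂ t₃ t₄ t₅ (m + j) ≡ layout 0 (λ i → f (m + i)) t₂ t₃ t₄ t₅ j
layout-+ zero    j = refl
layout-+ (suc m) {f} j = layout-+ m {f ∘ suc} j

layout-ind : ∀ m {f t₂ t₃ t₄ t₅} (P : ℕ → ℕ → Set) → (∀ k → k ≤ suc m → P k (f k)) →
             P (m + 2) t₂ → P (m + 3) t₃ → P (m + 4) t₄ → P (m + 5) t₅ →
             ∀ k → k < suc m + 5 → P k (layout m f t₂ t₃ t₄ t₅ k)
layout-ind m       P low p₂ p₃ p₄ p₅ zero _ = low 0 z≤n
layout-ind zero    P low p₂ p₃ p₄ p₅ 1 _ = low 1 (s≤s z≤n)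
layout-ind zero    P low p₂ p₃ p₄ p₅ 2 _ = p₂
layout-ind zero    P low p₂ p₃ p₄ p₅ 3 _ = p₃
layout-ind zero    P low p₂ p₃ p₄ p₅ 4 _ = p₄
layout-ind zero    P low p₂ p₃ p₄ p₅ 5 _ = p₅
layout-ind zero    P low p₂ p₃ p₄ p₅ (suc (suc (suc (suc (suc (suc _)))))) (s≤s (s≤s (s≤s (s≤s (s≤s (s≤s ()))))))
layout-ind (suc m) {f} P low p₂ p₃ p₄ p₅ (suc k) (s≤s k<) =
  layout-ind m {f ∘ suc} (P ∘ suc) (λ k k≤ → low (suc k) (s≤s k≤)) p₂ p₃ p₄ p₅ k k<

get-tabulate : ∀ {m} (g : ℕ → ℕ) {k} → k < m → get {m} (g ∘ toℕ) k ≡ g k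
get-tabulate {suc m} g {zero}  _         = refl
get-tabulate {suc m} g {suc k} (s≤s k<m) = get-tabulate {m} (g ∘ suc) k<m

get-toℕ : ∀ {m} (y : Fin m → ℕ) i → get y (toℕ i) ≡ y i
get-toℕ y F.zero    = refl
get-toℕ y (F.suc i) = get-toℕ (y ∘ F.suc) i

^-2^-suc : ∀ c k → c ^ 2 ^ suc k ≡ c ^ 2 ^ k * c ^ 2 ^ k
^-2^-suc c k = begin
  c ^ (2 ^ k + (2 ^ k + 0))   ≡⟨ ^-distribˡ-+-* c (2 ^ k) (2 ^ k + 0) ⟩
  c ^ 2 ^ k * c ^ (2 ^ k + 0) ≡⟨ cong (λ e → c ^ 2 ^ k * c ^ e) (+-identityʳ (2 ^ k)) ⟩
  c ^ 2 ^ k * c ^ 2 ^ k       ∎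
  where open ≡-Reasoning

-- With n = m + 1, X y (n + j) reduces to get y (m + j); positions are addressed that way below.
entries : ℕ → ℕ → ℕ → ℕ
entries m c = layout m (λ k → c ^ 2 ^ k) (1 + c) (2 + c) (c ^ 2 ^ suc m + 1) ((c ^ 2 ^ suc m + 1) / (2 + c))

candidate : ∀ m → ℕ → Assignment (suc m)
candidate m c = entries m c ∘ toℕ

module _ {m} {y : Assignment (suc m)} (sys : System (suc m) y) where
  open ≡-Reasoning
  private
    x₁ : ℕ
    x₁ = get y 0

    squares : ∀ i → 1 ≤ i → i ≤ suc m → get y (i ∸ 1) * get y (i ∸ 1) ≡ get y i
    squares = proj₁ sys

    x₁+1≡x[n+2] : x₁ + 1 ≡ get y (m + 2)
    x₁+1≡x[n+2] = proj₁ (proj₂ sys)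

    x[n+2]+1≡x[n+3] : get y (m + 2) + 1 ≡ get y (m + 3)
    x[n+2]+1≡x[n+3] = proj₁ (proj₂ (proj₂ sys))

    x[n+1]+1≡x[n+4] : get y (m + 1) + 1 ≡ get y (m + 4)
    x[n+1]+1≡x[n+4] = proj₁ (proj₂ (proj₂ (proj₂ sys)))

    x[n+3]*x[n+5]≡x[n+4] : get y (m + 3) * get y (m + 5) ≡ get y (m + 4)
    x[n+3]*x[n+5]≡x[n+4] = proj₂ (proj₂ (proj₂ (proj₂ sys)))

  system⇒powers : ∀ k → k ≤ suc m → get y k ≡ x₁ ^ 2 ^ k
  system⇒powers zero    _   = sym (^-identityʳ x₁)
  system⇒powers (suc k) k< = begin
    get y (suc k)          ≡⟨ squares (suc k) (s≤s z≤n) k< ⟨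
    get y k * get y k      ≡⟨ cong (λ a → a * a) (system⇒powers k (<⇒≤ k<)) ⟩
    x₁ ^ 2 ^ k * x₁ ^ 2 ^ k ≡⟨ ^-2^-suc x₁ k ⟨
    x₁ ^ 2 ^ suc k         ∎

  system⇒x[n+2] : get y (m + 2) ≡ 1 + x₁
  system⇒x[n+2] = trans (sym x₁+1≡x[n+2]) (+-comm x₁ 1)

  system⇒x[n+3] : get y (m + 3) ≡ 2 + x₁
  system⇒x[n+3] = begin
    get y (m + 3)          ≡⟨ x[n+2]+1≡x[n+3] ⟨
    get y (m + 2) + 1      ≡⟨ cong (_+ 1) system⇒x[n+2] ⟩
    1 + x₁ + 1             ≡⟨ +-comm (1 + x₁) 1 ⟩
    2 + x₁                 ∎

  system⇒x[n+4] : get y (m + 4) ≡ x₁ ^ 2 ^ suc m + 1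
  system⇒x[n+4] = begin
    get y (m + 4)          ≡⟨ x[n+1]+1≡x[n+4] ⟨
    get y (m + 1) + 1      ≡⟨ cong (λ k → get y k + 1) (+-comm m 1) ⟩
    get y (suc m) + 1      ≡⟨ cong (_+ 1) (system⇒powers (suc m) ≤-refl) ⟩
    x₁ ^ 2 ^ suc m + 1     ∎

  system⇒product : (2 + x₁) * get y (m + 5) ≡ x₁ ^ 2 ^ suc m + 1
  system⇒product = begin
    (2 + x₁) * get y (m + 5)    ≡⟨ cong (_* get y (m + 5)) system⇒x[n+3] ⟨
    get y (m + 3) * get y (m + 5) ≡⟨ x[n+3]*x[n+5]≡x[n+4] ⟩
    get y (m + 4)               ≡⟨ system⇒x[n+4] ⟩
    x₁ ^ 2 ^ suc m + 1          ∎

  system⇒2+x₁∣x₁^2^n+1 : 2 + x₁ ∣ x₁ ^ 2 ^ suc m + 1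
  system⇒2+x₁∣x₁^2^n+1 = divides (get y (m + 5)) (trans (sym system⇒product) (*-comm (2 + x₁) (get y (m + 5))))

  system⇒x[n+5] : get y (m + 5) ≡ (x₁ ^ 2 ^ suc m + 1) / (2 + x₁)
  system⇒x[n+5] = begin
    get y (m + 5)                       ≡⟨ m*n/n≡m (get y (m + 5)) (2 + x₁) ⟨
    get y (m + 5) * (2 + x₁) / (2 + x₁) ≡⟨ cong (_/ (2 + x₁)) (trans (*-comm (get y (m + 5)) (2 + x₁)) system⇒product) ⟩
    (x₁ ^ 2 ^ suc m + 1) / (2 + x₁)     ∎

  system⇒candidate : ∀ i → y i ≡ candidate m x₁ i
  system⇒candidate i = trans (sym (get-toℕ y i)) (entries≡ (toℕ i) (toℕ<n i))
    where
    entries≡ : ∀ k → k < suc m + 5 → get y k ≡ entries m x₁ k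
    entries≡ = layout-ind m (λ k v → get y k ≡ v)
      system⇒powers system⇒x[n+2] system⇒x[n+3] system⇒x[n+4] system⇒x[n+5]

module _ {m c : ℕ} where
  open ≡-Reasoning

  get-candidate-≤ : ∀ {k} → k ≤ suc m → get (candidate m c) k ≡ c ^ 2 ^ k
  get-candidate-≤ {k} k≤ = trans (get-tabulate (entries m c) (≤-<-trans k≤ (m<m+n (suc m) z<s))) (layout-≤ m k≤)

  get-candidate-+ : ∀ j → j ≤ 5 → get (candidate m c) (m + j) ≡
                    layout 0 (λ i → c ^ 2 ^ (m + i)) (1 + c) (2 + c) (c ^ 2 ^ suc m + 1) ((c ^ 2 ^ suc m + 1) / (2 + c)) j
  get-candidate-+ j j≤5 = trans (get-tabulate (entries m c) (s≤s (+-monoʳ-≤ m j≤5))) (layout-+ m j)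

  candidate-system : 2 + c ∣ c ^ 2 ^ suc m + 1 → System (suc m) (candidate m c)
  candidate-system 2+c∣ = squares , x₁+1≡x[n+2] , x[n+2]+1≡x[n+3] , x[n+1]+1≡x[n+4] , x[n+3]*x[n+5]≡x[n+4]
    where
    x : ℕ → ℕ
    x = get (candidate m c)

    squares : ∀ i → 1 ≤ i → i ≤ suc m → x (i ∸ 1) * x (i ∸ 1) ≡ x i
    squares (suc k) _ k< = begin
      x k * x k              ≡⟨ cong₂ _*_ (get-candidate-≤ (<⇒≤ k<)) (get-candidate-≤ (<⇒≤ k<)) ⟩
      c ^ 2 ^ k * c ^ 2 ^ k  ≡⟨ ^-2^-suc c k ⟨
      c ^ 2 ^ suc k          ≡⟨ get-candidate-≤ k< ⟨
      x (suc k)              ∎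

    x₁+1≡x[n+2] : c ^ 1 + 1 ≡ x (m + 2)
    x₁+1≡x[n+2] = begin
      c ^ 1 + 1              ≡⟨ cong (_+ 1) (^-identityʳ c) ⟩
      c + 1                  ≡⟨ +-comm c 1 ⟩
      1 + c                  ≡⟨ get-candidate-+ 2 (s≤s (s≤s z≤n)) ⟨
      x (m + 2)              ∎

    x[n+2]+1≡x[n+3] : x (m + 2) + 1 ≡ x (m + 3)
    x[n+2]+1≡x[n+3] = begin
      x (m + 2) + 1          ≡⟨ cong (_+ 1) (get-candidate-+ 2 (s≤s (s≤s z≤n))) ⟩
      1 + c + 1              ≡⟨ +-comm (1 + c) 1 ⟩
      2 + c                  ≡⟨ get-candidate-+ 3 (s≤s (s≤s (s≤s z≤n))) ⟨
      x (m + 3)              ∎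

    x[n+1]+1≡x[n+4] : x (m + 1) + 1 ≡ x (m + 4)
    x[n+1]+1≡x[n+4] = begin
      x (m + 1) + 1          ≡⟨ cong (_+ 1) (get-candidate-+ 1 (s≤s z≤n)) ⟩
      c ^ 2 ^ (m + 1) + 1    ≡⟨ cong (λ k → c ^ 2 ^ k + 1) (+-comm m 1) ⟩
      c ^ 2 ^ suc m + 1      ≡⟨ get-candidate-+ 4 (s≤s (s≤s (s≤s (s≤s z≤n)))) ⟨
      x (m + 4)              ∎

    x[n+3]*x[n+5]≡x[n+4] : x (m + 3) * x (m + 5) ≡ x (m + 4)
    x[n+3]*x[n+5]≡x[n+4] = begin
      x (m + 3) * x (m + 5)  ≡⟨ cong₂ _*_ (get-candidate-+ 3 (s≤s (s≤s (s≤s z≤n)))) (get-candidate-+ 5 ≤-refl) ⟩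
      (2 + c) * ((c ^ 2 ^ suc m + 1) / (2 + c)) ≡⟨ m*[n/m]≡n 2+c∣ ⟩
      c ^ 2 ^ suc m + 1      ≡⟨ get-candidate-+ 4 (s≤s (s≤s (s≤s (s≤s z≤n)))) ⟨
      x (m + 4)              ∎

module _ {c : ℕ} (2≤c : 2 ≤ c) where
  private instance
    c≢0 : NonZero c
    c≢0 = >-nonZero (≤-trans (s≤s z≤n) 2≤c)

  c≤c^2^k : ∀ k → c ≤ c ^ 2 ^ k
  c≤c^2^k k = subst (_≤ c ^ 2 ^ k) (^-identityʳ c) (^-monoʳ-≤ c (m^n>0 2 k))

  2+c≤c^2^[1+k]+1 : ∀ k → 2 + c ≤ c ^ 2 ^ suc k + 1
  2+c≤c^2^[1+k]+1 k = begin
    2 + c                  ≡⟨ +-comm 1 (1 + c) ⟩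
    1 + c + 1              ≤⟨ +-monoˡ-≤ 1 (m<m*n c c 2≤c) ⟩
    c * c + 1              ≤⟨ +-monoˡ-≤ 1 (*-mono-≤ (c≤c^2^k k) (c≤c^2^k k)) ⟩
    c ^ 2 ^ k * c ^ 2 ^ k + 1 ≡⟨ cong (_+ 1) (^-2^-suc c k) ⟨
    c ^ 2 ^ suc k + 1      ∎
    where open ≤-Reasoning

  candidate-positive : ∀ m i → 1 ≤ candidate m c i
  candidate-positive m i = layout-ind m (λ _ v → 1 ≤ v)
    (λ k _ → ≤-trans (≤-trans (s≤s z≤n) 2≤c) (c≤c^2^k k)) (s≤s z≤n) (s≤s z≤n) (m≤n+m 1 _)
    (m≥n⇒m/n>0 (2+c≤c^2^[1+k]+1 m)) (toℕ i) (toℕ<n i)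

  candidate-≤-x[n+4] : ∀ m i → candidate m c i ≤ c ^ 2 ^ suc m + 1
  candidate-≤-x[n+4] m i = layout-ind m (λ _ v → v ≤ c ^ 2 ^ suc m + 1)
    (λ k k≤ → ≤-trans (^-monoʳ-≤ c (^-monoʳ-≤ 2 k≤)) (m≤m+n _ 1))
    (≤-trans (n≤1+n (1 + c)) (2+c≤c^2^[1+k]+1 m)) (2+c≤c^2^[1+k]+1 m) ≤-refl
    (m/n≤m (c ^ 2 ^ suc m + 1) (2 + c)) (toℕ i) (toℕ<n i)

2+[2^2^n∸1]≡2^2^n+1 : ∀ n → 2 + (2 ^ 2 ^ n ∸ 1) ≡ 2 ^ 2 ^ n + 1
2+[2^2^n∸1]≡2^2^n+1 n = begin
  2 + (F ∸ 1)            ≡⟨ +-comm 2 (F ∸ 1) ⟩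
  F ∸ 1 + 2              ≡⟨ +-assoc (F ∸ 1) 1 1 ⟨
  F ∸ 1 + 1 + 1          ≡⟨ cong (_+ 1) (m∸n+n≡m (m^n>0 2 (2 ^ n))) ⟩
  F + 1                  ∎
  where
  open ≡-Reasoning
  F : ℕ
  F = 2 ^ 2 ^ n

2≤2^2^n∸1 : ∀ m → 2 ≤ 2 ^ 2 ^ suc m ∸ 1
2≤2^2^n∸1 m = ≤-trans (n≤1+n 2) (∸-monoˡ-≤ 1 (^-monoʳ-≤ 2 (*-monoʳ-≤ 2 (m^n>0 2 m))))

2+c∣c^2^n+1⇒c≡2^2^n∸1 : ∀ m {c} → Prime (2 ^ 2 ^ suc m + 1) →
                         2 + c ∣ c ^ 2 ^ suc m + 1 → c ≡ 2 ^ 2 ^ suc m ∸ 1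
2+c∣c^2^n+1⇒c≡2^2^n∸1 m {c} fermat-prime 2+c∣ = +-cancelˡ-≡ 2 c _ (begin
  2 + c                  ≡⟨ 2+c∣p⇒2+c≡p fermat-prime (∣-resp-mod (c^[2e]+1≡2^[2e]+1-mod-2+c c (2 ^ m)) 2+c∣) ⟩
  2 ^ 2 ^ suc m + 1      ≡⟨ 2+[2^2^n∸1]≡2^2^n+1 (suc m) ⟨
  2 + (2 ^ 2 ^ suc m ∸ 1) ∎)
  where open ≡-Reasoning

2+A∣A^2^n+1 : ∀ m → let A = 2 ^ 2 ^ suc m ∸ 1 in 2 + A ∣ A ^ 2 ^ suc m + 1
2+A∣A^2^n+1 m = ∣-resp-mod (sym (c^[2e]+1≡2^[2e]+1-mod-2+c A (2 ^ m)))
                 (subst (2 + A ∣_) (2+[2^2^n∸1]≡2^2^n+1 (suc m)) ∣-refl)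
  where
  A : ℕ
  A = 2 ^ 2 ^ suc m ∸ 1

theorem3 : (n : ℕ) → 1 ≤ n → Prime (2 ^ (2 ^ n) + 1) →
    ∃[ a ] (System n a
      × (∀ b → System n b → ∀ i → b i ≡ a i)
      × (∀ i → 1 ≤ a i)
      × (∀ i → a i ≤ X a (n + 4))
      × (X a (n + 4) ≡ (2 ^ (2 ^ n) ∸ 1) ^ (2 ^ n) + 1))
theorem3 (suc m) _ fermat-prime =
  a , candidate-system (2+A∣A^2^n+1 m) , unique , candidate-positive 2≤A m
    , (λ i → subst (a i ≤_) (sym x[n+4]≡) (candidate-≤-x[n+4] 2≤A m i)) , x[n+4]≡
  where
  A : ℕ
  A = 2 ^ 2 ^ suc m ∸ 1

  a : Assignment (suc m)
  a = candidate m A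

  2≤A : 2 ≤ A
  2≤A = 2≤2^2^n∸1 m

  x[n+4]≡ : get a (m + 4) ≡ A ^ 2 ^ suc m + 1
  x[n+4]≡ = get-candidate-+ {m} {A} 4 (s≤s (s≤s (s≤s (s≤s z≤n))))

  unique : ∀ b → System (suc m) b → ∀ i → b i ≡ a i
  unique b sys i = trans (system⇒candidate sys i)
    (cong (λ c → candidate m c i) (2+c∣c^2^n+1⇒c≡2^2^n∸1 m fermat-prime (system⇒2+x₁∣x₁^2^n+1 sys)))
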